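{- Let ${\bf n}$ be the fixed point starting with $0$ of the morphism $0\mapsto01$, $1\mapsto2$, $2\mapsto0$, and for $m\ge1$ let $A_m$ be the least integer $x$ such that every length-$m$ factor of ${\bf n}$ occurs in ${\bf n}$ at some starting position $\le x$ (positions indexed from $0$). Then $A_m/m\le \alpha^2+\alpha\approx3.61347026758$ for all $m\ge1$, where $\alpha$ is the real root of $X^3-X^2-1$, and the constant is optimal: $\sup_{m\ge1}A_m/m=\alpha^2+\alpha$. -}

module Defs where

open import Data.Nat using (ℕ; zero; suc; _+_; _≤_)
open import Data.Fin using (Fin; toℕ)
open import Data.List using (List; []; _∷_; concatMap)
open import Data.Product using (Σ; _×_; ∃)
open import Relation.Binary.PropositionalEquality using (_≡_)
open import Data.Integer using (+_)
import Data.Rational as ℚ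
open ℚ using (ℚ; 1ℚ)

Letter : Set
Letter = Fin 3

φ : Letter → List Letter
φ Fin.zero = Fin.zero ∷ Fin.suc Fin.zero ∷ []
φ (Fin.suc Fin.zero) = Fin.suc (Fin.suc Fin.zero) ∷ []
φ (Fin.suc (Fin.suc Fin.zero)) = Fin.zero ∷ []

φ^ : ℕ → List Letter
φ^ zero = Fin.zero ∷ []
φ^ (suc k) = concatMap φ (φ^ k)

-- i-th letter of a list (default 0 when out of range; never used below,
-- since |φ^k(0)| ≥ k+1).
nth : List Letter → ℕ → Letter
nth [] _ = Fin.zero
nth (x ∷ xs) zero = x
nth (x ∷ xs) (suc i) = nth xs i

-- The fixed point 𝐧 = lim φ^k(0); its i-th letter (positions from 0)
-- is the i-th letter of φ^i(0), which has length > i and is a prefix of 𝐧.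
𝐧 : ℕ → Letter
𝐧 i = nth (φ^ i) i

factor : (m i : ℕ) → Fin m → Letter
factor m i k = 𝐧 (i + toℕ k)

Covers : ℕ → ℕ → Set
Covers m x = ∀ i → Σ ℕ (λ j → j ≤ x × (∀ k → factor m j k ≡ factor m i k))

IsA : ℕ → ℕ → Set
IsA m x = Covers m x × (∀ y → Covers m y → x ≤ y)

toℚ : ℕ → ℚ
toℚ n = + n ℚ./ 1

-- f(a) = a³ - a² - 1 ; α is its unique real root, f < 0 below α, f > 0 above.
cubic : ℚ → ℚ
cubic a = a ℚ.* a ℚ.* a ℚ.- a ℚ.* a ℚ.- 1ℚ

-- g(a) = a² + a (increasing for a ≥ 0); the constant is g(α) = α² + α.
sq+ : ℚ → ℚ
sq+ a = a ℚ.* a ℚ.+ a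

{-# OPTIONS --safe #-}
module Submission where

-- Write N k = |φ^k(0)|, so that φ^(k+3)(0) = φ^(k+2)(0) φ^k(0), and B(k+2) = N k + B k, B 0 = B 1 = 0.
-- The shift of 𝐧 by N k agrees with 𝐧 on exactly B k letters, so every factor of length at
-- most B k + 1 already occurs before N(k+2).  Conversely, following first mismatches shows that
-- before N(k+3) the prefix of length B k + 1 recurs only at N(k+1) and N(k+2), where it is
-- preceded by a letter different from the last letter of φ^(k+3)(0).  Hence A_m = N(k+3) − 1
-- for m = B k + 2 (k ≥ 1) and A_m ≤ N(k+3) − 1 up to m = B(k+1) + 1, so both claims compare
-- N(k+3) − 1 with c (B k + 2), where c = a² + a.
--
-- With u(k+3) = u(k+2) + u k one has 3 N(k+3) = u(k+2) + u(k+1) and 3 (B k + 2) − u k ∈ {1, 2},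
-- which turns both comparisons into bounds on τ k = u(k+2) + u(k+1) − c u k.  For a > α, the
-- product of c + 3 − τ k with the positive weight u k + (a² − a) u(k+1) + a u(k+2) is a sum of
-- nonnegative terms, because the Cassini-type quantity D obeys D(k+3) = D k − D(k+1) and hence
-- stays below u(k+4) in absolute value.  For a < α, the combination
-- τ k + (a² − a) τ(k+1) + a τ(k+2) = −cubic(a) (u(k+2) + (a + 1) u(k+1)) is unbounded, so some
-- τ exceeds 2c + 3.

open import Defs

module Sequences where

  open import Data.Empty using (⊥-elim)
  open import Data.Nat using (ℕ; zero; suc; _+_; _*_; _∸_; _≤_; _<_; _≤′_; ≤′-refl; ≤′-step; z≤n; s≤s; _≤?_)
  open import Data.Nat.Properties
  open import Algebra.Properties.CommutativeSemigroup +-commutativeSemigroup using (interchange; xy∙z≈xz∙y)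
  open import Data.Nat.Tactic.RingSolver using (solve-∀)
  open import Data.Product using (∃-syntax; _×_; _,_)
  open import Relation.Nullary using (yes; no)
  open import Relation.Binary.PropositionalEquality

  <⇒≤∸1 : ∀ {p n} → p < n → p ≤ n ∸ 1
  <⇒≤∸1 (s≤s p≤n) = p≤n

  module _ (f : ℕ → ℕ) where

    suc-mono-≤⇒mono-≤ : (∀ n → f n ≤ f (suc n)) → ∀ {m n} → m ≤ n → f m ≤ f n
    suc-mono-≤⇒mono-≤ f-suc {m} m≤n = go (≤⇒≤′ m≤n)
      where
      go : ∀ {n} → m ≤′ n → f m ≤ f n
      go ≤′-refl         = ≤-refl
      go (≤′-step m≤′n) = ≤-trans (go m≤′n) (f-suc _)

    module StrictlyIncreasing (f-suc : ∀ n → f n < f (suc n)) where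

      mono-≤ : ∀ {m n} → m ≤ n → f m ≤ f n
      mono-≤ = suc-mono-≤⇒mono-≤ (λ n → <⇒≤ (f-suc n))

      mono-< : ∀ {m n} → m < n → f m < f n
      mono-< {m} m<n = <-≤-trans (f-suc m) (mono-≤ m<n)

      cancel-< : ∀ {m n} → f m < f n → m < n
      cancel-< fm<fn = ≰⇒> (λ n≤m → <⇒≱ fm<fn (mono-≤ n≤m))

      f[0]+n≤f[n] : ∀ n → f 0 + n ≤ f n
      f[0]+n≤f[n] zero    = ≤-reflexive (+-identityʳ (f 0))
      f[0]+n≤f[n] (suc n) = ≤-trans (≤-reflexive (+-suc (f 0) n)) (≤-<-trans (f[0]+n≤f[n] n) (f-suc n))

      bracket : ∀ {q} → f 0 ≤ q → ∃[ j ] f j ≤ q × q < f (suc j)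
      bracket {q} f0≤q = search (suc q) (≤-trans (m≤n+m (suc q) (f 0)) (f[0]+n≤f[n] (suc q)))
        where
        search : ∀ n → q < f n → ∃[ j ] f j ≤ q × q < f (suc j)
        search zero    q<f0 = ⊥-elim (<⇒≱ q<f0 f0≤q)
        search (suc n) q<fn with f n ≤? q
        ... | yes fn≤q = n , fn≤q , q<fn
        ... | no  fn≰q = search n (≰⇒> fn≰q)

  N : ℕ → ℕ
  N 0 = 1
  N 1 = 2
  N 2 = 3
  N (suc (suc (suc k))) = N (suc (suc k)) + N k

  B : ℕ → ℕ
  B 0 = 0
  B 1 = 0
  B (suc (suc k)) = N k + B k

  N-pos : ∀ k → 1 ≤ N k
  N-pos 0 = s≤s z≤n
  N-pos 1 = s≤s z≤n
  N-pos 2 = s≤s z≤n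
  N-pos (suc (suc (suc k))) = ≤-trans (N-pos (suc (suc k))) (m≤m+n _ _)

  N-suc-< : ∀ k → N k < N (suc k)
  N-suc-< 0 = s≤s (s≤s z≤n)
  N-suc-< 1 = s≤s (s≤s (s≤s z≤n))
  N-suc-< 2 = s≤s (s≤s (s≤s (s≤s z≤n)))
  N-suc-< (suc (suc (suc k))) = m<m+n (N (3 + k)) (N-pos (1 + k))

  open StrictlyIncreasing N N-suc-< public
    renaming ( mono-≤ to N-mono-≤; mono-< to N-mono-<; cancel-< to N-cancel-<
             ; f[0]+n≤f[n] to n<N[n]; bracket to N-bracket )

  B<N : ∀ k → B k < N (suc k)
  B<N 0 = s≤s z≤n
  B<N 1 = s≤s z≤n
  B<N (suc (suc k)) = begin-strict
    N k + B k         <⟨ +-monoʳ-< (N k) (B<N k) ⟩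
    N k + N (1 + k)   ≤⟨ +-monoʳ-≤ (N k) (N-mono-≤ (n≤1+n (1 + k))) ⟩
    N k + N (2 + k)   ≡⟨ +-comm (N k) (N (2 + k)) ⟩
    N (3 + k)         ∎
    where open ≤-Reasoning

  B-suc-< : ∀ k → B (suc k) < B (suc (suc k))
  B-suc-< 0 = s≤s z≤n
  B-suc-< 1 = s≤s (s≤s z≤n)
  B-suc-< (suc (suc k)) = +-mono-< (N-suc-< (suc k)) (B-suc-< k)

  B-mono-≤ : ∀ {j k} → j ≤ k → B j ≤ B k
  B-mono-≤ = suc-mono-≤⇒mono-≤ B B-suc-≤
    where
    B-suc-≤ : ∀ k → B k ≤ B (suc k)
    B-suc-≤ zero    = z≤n
    B-suc-≤ (suc k) = <⇒≤ (B-suc-< k)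

  B-bracket : ∀ {m} → 2 ≤ m → ∃[ j ] 2 + B (suc j) ≤ m × m < 2 + B (2 + j)
  B-bracket = StrictlyIncreasing.bracket (λ j → 2 + B (suc j)) (λ j → +-monoʳ-< 2 (B-suc-< j))

  u : ℕ → ℕ
  u 0 = 4
  u 1 = 5
  u 2 = 7
  u (suc (suc (suc k))) = u (suc (suc k)) + u k

  3N[3+k]≡u[2+k]+u[1+k] : ∀ k → 3 * N (3 + k) ≡ u (2 + k) + u (1 + k)
  3N[3+k]≡u[2+k]+u[1+k] 0 = refl
  3N[3+k]≡u[2+k]+u[1+k] 1 = refl
  3N[3+k]≡u[2+k]+u[1+k] 2 = refl
  3N[3+k]≡u[2+k]+u[1+k] k@(suc (suc (suc j))) = begin
    3 * (N (2 + k) + N k)                         ≡⟨ *-distribˡ-+ 3 (N (2 + k)) (N k) ⟩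
    3 * N (2 + k) + 3 * N k                       ≡⟨ cong₂ _+_ (3N[3+k]≡u[2+k]+u[1+k] (suc (suc j)))
                                                                 (3N[3+k]≡u[2+k]+u[1+k] j) ⟩
    (u (1 + k) + u k) + (u (2 + j) + u (1 + j))   ≡⟨ interchange (u (1 + k)) (u k) (u (2 + j)) (u (1 + j)) ⟩
    u (2 + k) + u (1 + k)                         ∎
    where open ≡-Reasoning

  u[2+k]≡u[k]+3N[k] : ∀ k → u (2 + k) ≡ u k + 3 * N k
  u[2+k]≡u[k]+3N[k] 0 = refl
  u[2+k]≡u[k]+3N[k] 1 = refl
  u[2+k]≡u[k]+3N[k] 2 = refl
  u[2+k]≡u[k]+3N[k] k@(suc (suc (suc j))) = begin
    u (1 + k) + u (2 + j)                           ≡⟨ cong₂ _+_ (u[2+k]≡u[k]+3N[k] (suc (suc j)))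
                                                                   (u[2+k]≡u[k]+3N[k] j) ⟩
    (u (2 + j) + 3 * N (2 + j)) + (u j + 3 * N j)   ≡⟨ interchange (u (2 + j)) (3 * N (2 + j)) (u j) (3 * N j) ⟩
    u k + (3 * N (2 + j) + 3 * N j)                 ≡⟨ cong (u k +_) (*-distribˡ-+ 3 (N (2 + j)) (N j)) ⟨
    u k + 3 * N k                                   ∎
    where open ≡-Reasoning

  3[2+B[2+k]]≡3[2+B[k]]+3N[k] : ∀ k → 3 * (2 + B (2 + k)) ≡ 3 * (2 + B k) + 3 * N k
  3[2+B[2+k]]≡3[2+B[k]]+3N[k] k = identity (N k) (B k)
    where
    identity : ∀ n b → 3 * (2 + (n + b)) ≡ 3 * (2 + b) + 3 * n
    identity = solve-∀

  u+1≤3[2+B] : ∀ k → u k + 1 ≤ 3 * (2 + B k)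
  u+1≤3[2+B] 0 = n≤1+n 5
  u+1≤3[2+B] 1 = ≤-refl
  u+1≤3[2+B] (suc (suc k)) = begin
    u (2 + k) + 1             ≡⟨ cong (_+ 1) (u[2+k]≡u[k]+3N[k] k) ⟩
    u k + 3 * N k + 1         ≡⟨ xy∙z≈xz∙y (u k) (3 * N k) 1 ⟩
    u k + 1 + 3 * N k         ≤⟨ +-monoˡ-≤ (3 * N k) (u+1≤3[2+B] k) ⟩
    3 * (2 + B k) + 3 * N k   ≡⟨ 3[2+B[2+k]]≡3[2+B[k]]+3N[k] k ⟨
    3 * (2 + B (2 + k))       ∎
    where open ≤-Reasoning

  3[2+B]≤u+2 : ∀ k → 3 * (2 + B k) ≤ u k + 2
  3[2+B]≤u+2 0 = ≤-refl
  3[2+B]≤u+2 1 = n≤1+n 6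
  3[2+B]≤u+2 (suc (suc k)) = begin
    3 * (2 + B (2 + k))       ≡⟨ 3[2+B[2+k]]≡3[2+B[k]]+3N[k] k ⟩
    3 * (2 + B k) + 3 * N k   ≤⟨ +-monoˡ-≤ (3 * N k) (3[2+B]≤u+2 k) ⟩
    u k + 2 + 3 * N k         ≡⟨ xy∙z≈xz∙y (u k) (3 * N k) 2 ⟨
    u k + 3 * N k + 2         ≡⟨ cong (_+ 2) (u[2+k]≡u[k]+3N[k] k) ⟨
    u (2 + k) + 2             ∎
    where open ≤-Reasoning

  k<u[k] : ∀ k → k < u k
  k<u[k] 0 = s≤s z≤n
  k<u[k] 1 = s≤s (s≤s z≤n)
  k<u[k] 2 = s≤s (s≤s (s≤s z≤n))
  k<u[k] (suc (suc (suc k))) =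
    subst (_≤ u (3 + k)) (+-comm (3 + k) 1) (+-mono-≤ (k<u[k] (suc (suc k))) (≤-trans (s≤s z≤n) (k<u[k] k)))

module Factors where

  open Sequences

  open import Data.Empty using (⊥; ⊥-elim)
  open import Data.Fin as Fin using (toℕ; fromℕ<)
  open import Data.Fin.Properties using (toℕ<n; toℕ-fromℕ<)
  open import Data.List using ([]; _∷_; _++_; length; concatMap)
  open import Data.List.Properties using (concatMap-++; length-++)
  open import Data.Nat using (ℕ; zero; suc; _+_; _∸_; _≤_; _<_; _≤′_; ≤′-refl; ≤′-step; z≤n; s≤s; _≤?_; _<?_; _≟_)
  open import Data.Nat.Induction using (<-rec)
  open import Data.Nat.Properties
  open import Data.Product using (∃-syntax; _×_; _,_; proj₁; proj₂)
  open import Data.Sum using (_⊎_; inj₁; inj₂)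
  open import Function using (_∘_)
  open import Relation.Nullary using (yes; no)
  open import Relation.Binary.PropositionalEquality

  φ^-split : ∀ k → φ^ (3 + k) ≡ φ^ (2 + k) ++ φ^ k
  φ^-split zero    = refl
  φ^-split (suc k) = trans (cong (concatMap φ) (φ^-split k)) (concatMap-++ φ (φ^ (2 + k)) (φ^ k))

  length-φ^ : ∀ k → length (φ^ k) ≡ N k
  length-φ^ 0 = refl
  length-φ^ 1 = refl
  length-φ^ 2 = refl
  length-φ^ k@(suc (suc (suc j))) = begin
    length (φ^ k)                       ≡⟨ cong length (φ^-split j) ⟩
    length (φ^ (2 + j) ++ φ^ j)         ≡⟨ length-++ (φ^ (2 + j)) ⟩
    length (φ^ (2 + j)) + length (φ^ j) ≡⟨ cong₂ _+_ (length-φ^ (suc (suc j))) (length-φ^ j) ⟩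
    N k                                 ∎
    where open ≡-Reasoning

  nth-++ˡ : ∀ xs ys {p} → p < length xs → nth (xs ++ ys) p ≡ nth xs p
  nth-++ˡ (x ∷ xs) ys {zero}  _         = refl
  nth-++ˡ (x ∷ xs) ys {suc p} (s≤s p<n) = nth-++ˡ xs ys p<n

  nth-++ʳ : ∀ xs ys r → nth (xs ++ ys) (length xs + r) ≡ nth ys r
  nth-++ʳ []       ys r = refl
  nth-++ʳ (x ∷ xs) ys r = nth-++ʳ xs ys r

  φ^-prefix : ∀ k → ∃[ ys ] φ^ (suc k) ≡ φ^ k ++ ys
  φ^-prefix 0             = _ , refl
  φ^-prefix 1             = _ , refl
  φ^-prefix (suc (suc k)) = φ^ k , φ^-split k

  nth-φ^-stable : ∀ {k K p} → k ≤ K → p < N k → nth (φ^ K) p ≡ nth (φ^ k) p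
  nth-φ^-stable {k} {p = p} k≤K p<Nk = go (≤⇒≤′ k≤K)
    where
    go : ∀ {K} → k ≤′ K → nth (φ^ K) p ≡ nth (φ^ k) p
    go ≤′-refl = refl
    go {suc K} (≤′-step k≤′K) with φ^-prefix K
    ... | ys , φ^[1+K]≡ = begin
      nth (φ^ (suc K)) p   ≡⟨ cong (λ w → nth w p) φ^[1+K]≡ ⟩
      nth (φ^ K ++ ys) p   ≡⟨ nth-++ˡ (φ^ K) ys (subst (p <_) (sym (length-φ^ K)) p<NK) ⟩
      nth (φ^ K) p         ≡⟨ go k≤′K ⟩
      nth (φ^ k) p         ∎
      where
      open ≡-Reasoning
      p<NK : p < N K
      p<NK = <-≤-trans p<Nk (N-mono-≤ (≤′⇒≤ k≤′K))

  𝐧-φ^ : ∀ K {p} → p < N K → 𝐧 p ≡ nth (φ^ K) p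
  𝐧-φ^ K {p} p<NK with ≤-total K p
  ... | inj₁ K≤p = nth-φ^-stable K≤p p<NK
  ... | inj₂ p≤K = sym (nth-φ^-stable p≤K (n<N[n] p))

  Agree : ℕ → ℕ → Set
  Agree q r = ∀ t → t < r → 𝐧 (q + t) ≡ 𝐧 t

  agree-N[2+k] : ∀ k → Agree (N (2 + k)) (N k)
  agree-N[2+k] k r r<Nk = begin
    𝐧 (N (2 + k) + r)                                   ≡⟨ 𝐧-φ^ (3 + k) (+-monoʳ-< (N (2 + k)) r<Nk) ⟩
    nth (φ^ (3 + k)) (N (2 + k) + r)                    ≡⟨ cong (λ w → nth w (N (2 + k) + r)) (φ^-split k) ⟩
    nth (φ^ (2 + k) ++ φ^ k) (N (2 + k) + r)            ≡⟨ cong (λ n → nth (φ^ (2 + k) ++ φ^ k) (n + r))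
                                                                 (sym (length-φ^ (2 + k))) ⟩
    nth (φ^ (2 + k) ++ φ^ k) (length (φ^ (2 + k)) + r)  ≡⟨ nth-++ʳ (φ^ (2 + k)) (φ^ k) r ⟩
    nth (φ^ k) r                                        ≡⟨ 𝐧-φ^ k r<Nk ⟨
    𝐧 r                                                 ∎
    where open ≡-Reasoning

  𝐧-N[2+k]+N[k] : ∀ k {s} → s < N (1 + k) → 𝐧 (N (2 + k) + (N k + s)) ≡ 𝐧 s
  𝐧-N[2+k]+N[k] k {s} s<N = trans (cong 𝐧 (sym (+-assoc (N (2 + k)) (N k) s))) (agree-N[2+k] (1 + k) s s<N)

  agree-N-B : ∀ k → Agree (N k) (B k)
  agree-N-B 0 _ ()
  agree-N-B 1 _ ()
  agree-N-B (suc (suc k)) r r<B with r <? N k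
  ... | yes r<Nk = agree-N[2+k] k r r<Nk
  ... | no  r≮Nk with m≤n⇒∃[o]m+o≡n (≮⇒≥ r≮Nk)
  ...   | s , refl = trans (𝐧-N[2+k]+N[k] k (<-trans s<Bk (B<N k))) (sym (agree-N-B k s s<Bk))
    where
    s<Bk : s < B k
    s<Bk = +-cancelˡ-< (N k) s (B k) r<B

  mismatch-N-B : ∀ k → 𝐧 (N k + B k) ≢ 𝐧 (B k)
  mismatch-N-B 0 ()
  mismatch-N-B 1 ()
  mismatch-N-B (suc (suc k)) eq = mismatch-N-B k (trans (sym eq) (𝐧-N[2+k]+N[k] k (B<N k)))

  N-split : ∀ j {q} → N (2 + j) ≤ q → q < N (3 + j) → ∃[ q′ ] q ≡ N (2 + j) + q′ × q′ < N j
  N-split j lo hi with m≤n⇒∃[o]m+o≡n lo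
  ... | q′ , refl = q′ , refl , +-cancelˡ-< (N (2 + j)) q′ (N j) hi

  N-greedy : ∀ {k q} → N (2 + k) ≤ q → ∃[ j ] ∃[ q′ ] k ≤ j × q ≡ N (2 + j) + q′ × q′ < N j
  N-greedy {k} {q} lo with N-bracket (≤-trans (N-pos (2 + k)) lo)
  ... | J , NJ≤q , q<NJ+1 with m≤n⇒∃[o]m+o≡n (≤-pred (N-cancel-< {2 + k} {suc J} (≤-<-trans lo q<NJ+1)))
  ...   | d , refl with N-split (k + d) NJ≤q q<NJ+1
  ...     | q′ , q≡ , q′<N = k + d , q′ , m≤m+n k d , q≡ , q′<N

  covers : ∀ k {m} → m ≤ suc (B k) → Covers m (N (2 + k) ∸ 1)
  covers k {m} m≤ i with <-rec _ occurs-before i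
    where
    OccursBefore : ℕ → Set
    OccursBefore p = ∃[ j ] j < N (2 + k) × (∀ t → factor m j t ≡ factor m p t)
    occurs-before : ∀ p → (∀ {p′} → p′ < p → OccursBefore p′) → OccursBefore p
    occurs-before p rec with p <? N (2 + k)
    ... | yes p<N = p , p<N , λ _ → refl
    ... | no  p≮N with N-greedy {k} (≮⇒≥ p≮N)
    ...   | j , p′ , k≤j , refl , p′<Nj with rec (m<n+m p′ (N-pos (2 + j)))
    ...     | i , i<N , same = i , i<N , λ t → trans (same t) (sym (shift t))
      where
      shift : ∀ t → factor m (N (2 + j) + p′) t ≡ factor m p′ t
      shift t = trans (cong 𝐧 (+-assoc (N (2 + j)) p′ (toℕ t)))
        (agree-N-B (2 + j) (p′ + toℕ t)
          (+-mono-<-≤ p′<Nj (≤-trans (≤-pred (<-≤-trans (toℕ<n t) m≤)) (B-mono-≤ k≤j))))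
  ... | j , j<N , same = j , <⇒≤∸1 j<N , same

  Mismatch : ℕ → ℕ → Set
  Mismatch q J = ∃[ t ] 𝐧 (q + t) ≢ 𝐧 t × q + t ≤ N J + B J × (q ≡ N J ⊎ t ≤ B (J ∸ 3))

  mismatch : ∀ q J → N J ≤ q → q < N (suc J) → Mismatch q J
  mismatch = <-rec _ step
    where
    step : ∀ q → (∀ {q′} → q′ < q → ∀ J → N J ≤ q′ → q′ < N (suc J) → Mismatch q′ J) →
           ∀ J → N J ≤ q → q < N (suc J) → Mismatch q J
    step q rec J lo hi with q ≟ N J
    ... | yes refl = B J , mismatch-N-B J , ≤-refl , inj₁ refl
    step q rec 0 lo hi | no q≢NJ = ⊥-elim (q≢NJ (≤-antisym (≤-pred hi) lo))
    step q rec 1 lo hi | no q≢NJ = ⊥-elim (q≢NJ (≤-antisym (≤-pred hi) lo))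
    step q rec (suc (suc j)) lo hi | no q≢NJ with N-split j lo hi
    ... | zero , q≡ , _ = ⊥-elim (q≢NJ (trans q≡ (+-identityʳ _)))
    ... | q′@(suc _) , refl , q′<Nj with N-bracket {q′} (s≤s z≤n)
    ...   | J′ , lo′ , hi′ with rec (m<n+m q′ (N-pos (2 + j))) J′ lo′ hi′
    ...     | t , ne , bnd , _ = t , ne′ , bnd′ , inj₂ (≤-trans t≤BJ′ (B-mono-≤ (<⇒≤∸1 J′<j)))
      where
      J′<j : J′ < j
      J′<j = N-cancel-< (≤-<-trans lo′ q′<Nj)
      q′+t<N+B : q′ + t < N j + B j
      q′+t<N+B = ≤-<-trans bnd (+-mono-<-≤ (N-mono-< J′<j) (B-mono-≤ (<⇒≤ J′<j)))
      ne′ : 𝐧 (N (2 + j) + q′ + t) ≢ 𝐧 t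
      ne′ eq = ne (trans (sym (agree-N-B (2 + j) (q′ + t) q′+t<N+B))
                         (trans (cong 𝐧 (sym (+-assoc (N (2 + j)) q′ t))) eq))
      bnd′ : N (2 + j) + q′ + t ≤ N (2 + j) + B (2 + j)
      bnd′ = ≤-trans (≤-reflexive (+-assoc (N (2 + j)) q′ t)) (+-monoʳ-≤ (N (2 + j)) (<⇒≤ q′+t<N+B))
      t≤BJ′ : t ≤ B J′
      t≤BJ′ = +-cancelˡ-≤ (N J′) t (B J′) (≤-trans (+-monoˡ-≤ t lo′) bnd)

  prefix-returns : ∀ k {q} → 1 ≤ q → q < N (3 + k) → Agree q (suc (B k)) → q ≡ N (1 + k) ⊎ q ≡ N (2 + k)
  prefix-returns k {q} 1≤q q<N agree with N-bracket 1≤q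
  ... | J , lo , hi with mismatch q J lo hi
  ...   | t , ne , bnd , q≡NJ⊎t≤ = conclude q≡NJ⊎t≤
    where
    Bk<t : B k < t
    Bk<t = ≰⇒> (λ t≤Bk → ne (agree t (s≤s t≤Bk)))
    t≤BJ : t ≤ B J
    t≤BJ = +-cancelˡ-≤ (N J) t (B J) (≤-trans (+-monoˡ-≤ t lo) bnd)
    k<J : k < J
    k<J = ≰⇒> (λ J≤k → <⇒≱ (<-≤-trans Bk<t t≤BJ) (B-mono-≤ J≤k))
    J≤2+k : J ≤ 2 + k
    J≤2+k = ≤-pred (N-cancel-< (≤-<-trans lo q<N))
    conclude : q ≡ N J ⊎ t ≤ B (J ∸ 3) → q ≡ N (1 + k) ⊎ q ≡ N (2 + k)
    conclude (inj₁ q≡NJ) with J ≟ suc k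
    ... | yes refl = inj₁ q≡NJ
    ... | no  J≢1+k = inj₂ (trans q≡NJ (cong N (≤-antisym J≤2+k (≤∧≢⇒< k<J (J≢1+k ∘ sym)))))
    conclude (inj₂ t≤B) =
      ⊥-elim (<⇒≱ Bk<t (≤-trans t≤B (B-mono-≤ (≤-trans (∸-monoˡ-≤ 3 J≤2+k) (m∸n≤m k 1)))))

  lastLetter : ℕ → Letter
  lastLetter k = 𝐧 (N k ∸ 1)

  lastLetter-period : ∀ k → lastLetter (3 + k) ≡ lastLetter k
  lastLetter-period k = trans (cong 𝐧 (+-∸-assoc (N (2 + k)) (N-pos k)))
                              (agree-N[2+k] k (N k ∸ 1) (∸-monoʳ-< {n = 1} {o = 0} (s≤s z≤n) (N-pos k)))

  Distinct₃ : Letter → Letter → Letter → Set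
  Distinct₃ x y z = x ≢ y × x ≢ z × y ≢ z

  lastLetter-distinct : ∀ k → Distinct₃ (lastLetter k) (lastLetter (1 + k)) (lastLetter (2 + k))
  lastLetter-distinct zero = (λ ()) , (λ ()) , (λ ())
  lastLetter-distinct (suc k) with lastLetter-distinct k
  ... | x≢y , x≢z , y≢z = y≢z , (λ eq → x≢y (sym (trans eq (lastLetter-period k))))
                                , (λ eq → x≢z (sym (trans eq (lastLetter-period k))))

  last-factor-occurrence : ∀ k {j} → let x = N (3 + k) ∸ 1 in
    (∀ t → factor (2 + B k) j t ≡ factor (2 + B k) x t) → 𝐧 j ≡ lastLetter k × Agree (suc j) (suc (B k))
  last-factor-occurrence k {j} same = 𝐧j≡lastLetter , agree
    where
    x : ℕ
    x = N (3 + k) ∸ 1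
    1+x≡N : suc x ≡ N (3 + k)
    1+x≡N = trans (+-comm 1 x) (m∸n+n≡m (N-pos (3 + k)))
    Bk<B[3+k] : B k < B (3 + k)
    Bk<B[3+k] = ≤-<-trans (B-mono-≤ (n≤1+n k)) (m<n+m _ (N-pos (1 + k)))
    𝐧j≡lastLetter : 𝐧 j ≡ lastLetter k
    𝐧j≡lastLetter = begin
      𝐧 j                          ≡⟨ cong 𝐧 (sym (+-identityʳ j)) ⟩
      factor (2 + B k) j Fin.zero  ≡⟨ same Fin.zero ⟩
      𝐧 (x + 0)                    ≡⟨ cong 𝐧 (+-identityʳ x) ⟩
      lastLetter (3 + k)           ≡⟨ lastLetter-period k ⟩
      lastLetter k                 ∎
      where open ≡-Reasoning
    agree : Agree (suc j) (suc (B k))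
    agree t t<1+Bk@(s≤s t≤Bk) = begin
      𝐧 (suc j + t)                                 ≡⟨ cong 𝐧 (sym (+-suc j t)) ⟩
      𝐧 (j + suc t)                                 ≡⟨ cong (λ i → 𝐧 (j + suc i)) (sym (toℕ-fromℕ< t<1+Bk)) ⟩
      factor (2 + B k) j (Fin.suc (fromℕ< t<1+Bk))  ≡⟨ same (Fin.suc (fromℕ< t<1+Bk)) ⟩
      𝐧 (x + suc (toℕ (fromℕ< t<1+Bk)))            ≡⟨ cong (λ i → 𝐧 (x + suc i)) (toℕ-fromℕ< t<1+Bk) ⟩
      𝐧 (x + suc t)                                 ≡⟨ cong 𝐧 (trans (+-suc x t) (cong (_+ t) 1+x≡N)) ⟩
      𝐧 (N (3 + k) + t)                             ≡⟨ agree-N-B (3 + k) t (≤-<-trans t≤Bk Bk<B[3+k]) ⟩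
      𝐧 t                                           ∎
      where open ≡-Reasoning

  Covers⇒N[3+k]∸1≤ : ∀ k {y} → Covers (2 + B k) y → N (3 + k) ∸ 1 ≤ y
  Covers⇒N[3+k]∸1≤ k {y} cov with cov (N (3 + k) ∸ 1)
  ... | j , j≤y , same with N (3 + k) ∸ 1 ≤? j
  ...   | yes x≤j = ≤-trans x≤j j≤y
  ...   | no  x≰j with last-factor-occurrence k {j} same
  ...     | 𝐧j≡lastLetter , agree = ⊥-elim (letters-differ (prefix-returns k (s≤s z≤n) 1+j<N agree))
    where
    1+j<N : suc j < N (3 + k)
    1+j<N = subst (suc j <_) (trans (+-comm 1 _) (m∸n+n≡m (N-pos (3 + k)))) (s≤s (≰⇒> x≰j))
    preceding : ∀ i → suc j ≡ N i → 𝐧 j ≡ lastLetter i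
    preceding i eq = cong (𝐧 ∘ (_∸ 1)) eq
    letters-differ : suc j ≡ N (1 + k) ⊎ suc j ≡ N (2 + k) → ⊥
    letters-differ (inj₁ eq) = proj₁ (lastLetter-distinct k) (trans (sym 𝐧j≡lastLetter) (preceding (1 + k) eq))
    letters-differ (inj₂ eq) = proj₁ (proj₂ (lastLetter-distinct k)) (trans (sym 𝐧j≡lastLetter) (preceding (2 + k) eq))

  IsA-2+B[1+k] : ∀ k → IsA (2 + B (suc k)) (N (4 + k) ∸ 1)
  IsA-2+B[1+k] k = covers (2 + k) (s≤s (B-suc-< k)) , λ y → Covers⇒N[3+k]∸1≤ (suc k)

  IsA-1≤2 : ∀ {x} → IsA 1 x → x ≤ 2
  IsA-1≤2 (_ , least) = least 2 (covers 0 (s≤s z≤n))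

  IsA-bracket : ∀ {m x} → 2 ≤ m → IsA m x → ∃[ k ] x ≤ N (3 + k) ∸ 1 × 2 + B k ≤ m
  IsA-bracket {m} 2≤m (_ , least) with B-bracket 2≤m
  ... | j , lo , hi = suc j , least _ (covers (2 + j) (≤-pred hi)) , lo

module Estimates where

  open Sequences using (N; B; u; N-pos; 3N[3+k]≡u[2+k]+u[1+k]; u+1≤3[2+B]; 3[2+B]≤u+2; k<u[k])
  open import Data.Integer as ℤ using (+_)
  import Data.Integer.Properties as ℤ
  import Data.Nat as ℕ
  import Data.Nat.Properties as ℕ
  import Data.Nat.Coprimality as Coprimality
  open import Data.Empty using (⊥-elim)
  open import Data.Maybe using (Maybe; just; nothing)
  open import Data.Product using (∃-syntax; _×_; _,_; proj₁; proj₂)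
  open import Data.Sum using (inj₁; inj₂)
  import Data.Rational as ℚ
  open import Data.Rational using (ℚ; mkℚ; 0ℚ; 1ℚ; _+_; _*_; _-_; _≤_; _<_; *<*; 1/_; toℚᵘ)
  open import Data.Rational using (positive; nonNegative; >-nonZero)
  open import Data.Rational.Properties
  import Data.Rational.Unnormalised as ℚᵘ
  import Data.Rational.Unnormalised.Properties as ℚᵘ
  open import Data.Unit using (tt)
  open import Level using (0ℓ)
  open import Relation.Binary.PropositionalEquality
  open import Relation.Nullary using (Dec; yes; no)
  open import Tactic.RingSolver using (solve-∀)
  open import Tactic.RingSolver.Core.AlmostCommutativeRing using (AlmostCommutativeRing; fromCommutativeRing)

  ℚ-ring : AlmostCommutativeRing 0ℓ 0ℓ
  ℚ-ring = fromCommutativeRing +-*-commutativeRing is-zero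
    where
    is-zero : ∀ x → Maybe (0ℚ ≡ x)
    is-zero x with x ≟ 0ℚ
    ... | yes x≡0 = just (sym x≡0)
    ... | no  _   = nothing

  two three : ℚ
  two   = 1ℚ + 1ℚ
  three = 1ℚ + 1ℚ + 1ℚ

  toℚ≡mkℚ : ∀ n → toℚ n ≡ mkℚ (+ n) 0 (Coprimality.sym (Coprimality.1-coprimeTo n))
  toℚ≡mkℚ n = normalize-coprime _

  toℚᵘ-toℚ : ∀ n → toℚᵘ (toℚ n) ≡ ℚᵘ.mkℚᵘ (+ n) 0
  toℚᵘ-toℚ n = cong toℚᵘ (toℚ≡mkℚ n)

  toℚ-+ : ∀ m n → toℚ (m ℕ.+ n) ≡ toℚ m + toℚ n
  toℚ-+ m n = toℚᵘ-injective (begin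
    toℚᵘ (toℚ (m ℕ.+ n))                   ≡⟨ toℚᵘ-toℚ (m ℕ.+ n) ⟩
    ℚᵘ.mkℚᵘ (+ (m ℕ.+ n)) 0                ≈⟨ ℚᵘ.*≡* eq ⟩
    ℚᵘ.mkℚᵘ (+ m) 0 ℚᵘ.+ ℚᵘ.mkℚᵘ (+ n) 0   ≡⟨ cong₂ ℚᵘ._+_ (toℚᵘ-toℚ m) (toℚᵘ-toℚ n) ⟨
    toℚᵘ (toℚ m) ℚᵘ.+ toℚᵘ (toℚ n)         ≈⟨ toℚᵘ-homo-+ (toℚ m) (toℚ n) ⟨
    toℚᵘ (toℚ m + toℚ n)                   ∎)
    where
    open ℚᵘ.≃-Reasoning
    eq : + (m ℕ.+ n) ℤ.* + 1 ≡ (+ m ℤ.* + 1 ℤ.+ + n ℤ.* + 1) ℤ.* + 1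
    eq rewrite ℤ.*-identityʳ (+ m) | ℤ.*-identityʳ (+ n) = cong (ℤ._* + 1) (ℤ.pos-+ m n)

  toℚ-* : ∀ m n → toℚ (m ℕ.* n) ≡ toℚ m * toℚ n
  toℚ-* m n = toℚᵘ-injective (begin
    toℚᵘ (toℚ (m ℕ.* n))                   ≡⟨ toℚᵘ-toℚ (m ℕ.* n) ⟩
    ℚᵘ.mkℚᵘ (+ (m ℕ.* n)) 0                ≈⟨ ℚᵘ.*≡* (cong (ℤ._* + 1) (ℤ.pos-* m n)) ⟩
    ℚᵘ.mkℚᵘ (+ m) 0 ℚᵘ.* ℚᵘ.mkℚᵘ (+ n) 0   ≡⟨ cong₂ ℚᵘ._*_ (toℚᵘ-toℚ m) (toℚᵘ-toℚ n) ⟨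
    toℚᵘ (toℚ m) ℚᵘ.* toℚᵘ (toℚ n)         ≈⟨ toℚᵘ-homo-* (toℚ m) (toℚ n) ⟨
    toℚᵘ (toℚ m * toℚ n)                   ∎)
    where open ℚᵘ.≃-Reasoning

  toℚ-mono-≤ : ∀ {m n} → m ℕ.≤ n → toℚ m ≤ toℚ n
  toℚ-mono-≤ {m} {n} m≤n = toℚᵘ-cancel-≤ (subst₂ ℚᵘ._≤_ (sym (toℚᵘ-toℚ m)) (sym (toℚᵘ-toℚ n))
    (ℚᵘ.*≤* (subst₂ ℤ._≤_ (sym (ℤ.*-identityʳ (+ m))) (sym (ℤ.*-identityʳ (+ n))) (ℤ.+≤+ m≤n))))

  <-toℚ : ∀ q → ∃[ n ] q < toℚ n
  <-toℚ (mkℚ (+ m) d c) = ℕ.suc m , subst (mkℚ (+ m) d c <_) (sym (toℚ≡mkℚ (ℕ.suc m)))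
    (*<* (subst₂ ℤ._<_ (sym (ℤ.*-identityʳ (+ m))) (ℤ.pos-* (ℕ.suc m) (ℕ.suc d))
      (ℤ.+<+ (ℕ.<-≤-trans (ℕ.n<1+n m) (ℕ.m≤m*n (ℕ.suc m) (ℕ.suc d))))))
  <-toℚ (mkℚ ℤ.-[1+ m ] d c) = 0 , *<* ℤ.-<+

  ≤⇒0≤- : ∀ {x y} → x ≤ y → 0ℚ ≤ y - x
  ≤⇒0≤- {x} {y} x≤y = subst (_≤ y - x) (+-inverseʳ x) (+-monoˡ-≤ (ℚ.- x) x≤y)

  <⇒0<- : ∀ {x y} → x < y → 0ℚ < y - x
  <⇒0<- {x} {y} x<y = subst (_< y - x) (+-inverseʳ x) (+-monoˡ-< (ℚ.- x) x<y)

  y-x+x≡y : ∀ x y → (y - x) + x ≡ y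
  y-x+x≡y = solve-∀ ℚ-ring

  0≤-⇒≤ : ∀ {x y} → 0ℚ ≤ y - x → x ≤ y
  0≤-⇒≤ {x} {y} 0≤y-x = subst₂ _≤_ (+-identityˡ x) (y-x+x≡y x y) (+-monoˡ-≤ x 0≤y-x)

  0<-⇒< : ∀ {x y} → 0ℚ < y - x → x < y
  0<-⇒< {x} {y} 0<y-x = subst₂ _<_ (+-identityˡ x) (y-x+x≡y x y) (+-monoˡ-< x 0<y-x)

  +-nonNeg : ∀ {x y} → 0ℚ ≤ x → 0ℚ ≤ y → 0ℚ ≤ x + y
  +-nonNeg {x} {y} 0≤x 0≤y = subst (_≤ x + y) (+-identityˡ 0ℚ) (+-mono-≤ 0≤x 0≤y)

  +-pos : ∀ {x y} → 0ℚ < x → 0ℚ ≤ y → 0ℚ < x + y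
  +-pos {x} {y} 0<x 0≤y = subst (_< x + y) (+-identityˡ 0ℚ) (+-mono-<-≤ 0<x 0≤y)

  *-nonNeg : ∀ {x y} → 0ℚ ≤ x → 0ℚ ≤ y → 0ℚ ≤ x * y
  *-nonNeg {x} {y} 0≤x 0≤y =
    nonNegative⁻¹ (x * y) {{nonNeg*nonNeg⇒nonNeg x {{nonNegative 0≤x}} y {{nonNegative 0≤y}}}}

  nonNeg-cancelʳ-pos : ∀ {x w} → 0ℚ < w → 0ℚ ≤ x * w → 0ℚ ≤ x
  nonNeg-cancelʳ-pos {x} {w} 0<w 0≤xw =
    *-cancelʳ-≤-pos w {{positive 0<w}} (subst (_≤ x * w) (sym (*-zeroˡ w)) 0≤xw)

  pos-cancelʳ-pos : ∀ {x w} → 0ℚ < w → 0ℚ < x * w → 0ℚ < x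
  pos-cancelʳ-pos {x} {w} 0<w 0<xw =
    *-cancelʳ-<-nonNeg w {{nonNegative (<⇒≤ 0<w)}} (subst (_< x * w) (sym (*-zeroˡ w)) 0<xw)

  0<1 : 0ℚ < 1ℚ
  0<1 = *<* (ℤ.+<+ (ℕ.s≤s ℕ.z≤n))

  0<3 : 0ℚ < three
  0<3 = *<* (ℤ.+<+ (ℕ.s≤s ℕ.z≤n))

  toℚ-nonNeg : ∀ n → 0ℚ ≤ toℚ n
  toℚ-nonNeg n = toℚ-mono-≤ {0} {n} ℕ.z≤n

  archimedean : ∀ x {ε} → 0ℚ < ε → ∃[ n ] x < ε * toℚ n
  archimedean x {ε} 0<ε = n , subst (_< ε * toℚ n) ε[x/ε]≡x (*-monoʳ-<-pos ε {{positive 0<ε}} x/ε<n)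
    where
    instance
      ε≢0 : ℚ.NonZero ε
      ε≢0 = >-nonZero 0<ε
    n : ℕ.ℕ
    n = proj₁ (<-toℚ (x * 1/ ε))
    x/ε<n : x * 1/ ε < toℚ n
    x/ε<n = proj₂ (<-toℚ (x * 1/ ε))
    rearrange : ∀ e x i → e * (x * i) ≡ x * (i * e)
    rearrange = solve-∀ ℚ-ring
    ε[x/ε]≡x : ε * (x * 1/ ε) ≡ x
    ε[x/ε]≡x = trans (rearrange ε x (1/ ε)) (trans (cong (x *_) (*-inverseˡ ε)) (*-identityʳ x))

  -- U is u recomputed in ℚ rather than toℚ ∘ u, so that U (3 + k) unfolds definitionally in the
  -- ring identities below.
  U : ℕ.ℕ → ℚ
  U 0 = toℚ 4
  U 1 = toℚ 5
  U 2 = toℚ 7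
  U (ℕ.suc (ℕ.suc (ℕ.suc k))) = U (ℕ.suc (ℕ.suc k)) + U k

  toℚ-u : ∀ k → toℚ (u k) ≡ U k
  toℚ-u 0 = refl
  toℚ-u 1 = refl
  toℚ-u 2 = refl
  toℚ-u (ℕ.suc (ℕ.suc (ℕ.suc k))) =
    trans (toℚ-+ (u (2 ℕ.+ k)) (u k)) (cong₂ _+_ (toℚ-u (ℕ.suc (ℕ.suc k))) (toℚ-u k))

  U-nonNeg : ∀ k → 0ℚ ≤ U k
  U-nonNeg k = subst (0ℚ ≤_) (toℚ-u k) (toℚ-nonNeg (u k))

  U-pos : ∀ k → 0ℚ < U k
  U-pos k = <-≤-trans 0<1 (subst (1ℚ ≤_) (toℚ-u k) (toℚ-mono-≤ (ℕ.≤-trans (ℕ.s≤s ℕ.z≤n) (k<u[k] k))))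

  D : ℕ.ℕ → ℚ
  D k = U k * (U (3 ℕ.+ k) + U (2 ℕ.+ k)) - U (1 ℕ.+ k) * (U (2 ℕ.+ k) + U (1 ℕ.+ k))

  D-rec : ∀ k → D (3 ℕ.+ k) ≡ D k - D (1 ℕ.+ k)
  D-rec k = identity (U k) (U (1 ℕ.+ k)) (U (2 ℕ.+ k))
    where
    identity : ∀ p q r → let u₃ = r + p; u₄ = u₃ + q; u₅ = u₄ + r; u₆ = u₅ + u₃ in
      u₃ * (u₆ + u₅) - u₄ * (u₅ + u₄) ≡ (p * (u₃ + r) - q * (r + q)) - (q * (u₄ + u₃) - r * (u₃ + r))
    identity = solve-∀ ℚ-ring

  D-bounded : ∀ k → 0ℚ ≤ U (4 ℕ.+ k) + D k × 0ℚ ≤ U (4 ℕ.+ k) - D k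
  D-bounded 0 = ≤ᵇ⇒≤ tt , ≤ᵇ⇒≤ tt
  D-bounded 1 = ≤ᵇ⇒≤ tt , ≤ᵇ⇒≤ tt
  D-bounded 2 = ≤ᵇ⇒≤ tt , ≤ᵇ⇒≤ tt
  D-bounded (ℕ.suc (ℕ.suc (ℕ.suc k))) with D-bounded k | D-bounded (1 ℕ.+ k)
  ... | lo₀ , hi₀ | lo₁ , hi₁ =
    subst (0ℚ ≤_) (sym (trans (cong (λ d → U (7 ℕ.+ k) + d) (D-rec k))
                              (rearrange⁺ u₄ u₅ u₃ (D k) (D (1 ℕ.+ k)))))
      (+-nonNeg (+-nonNeg lo₀ hi₁) (U-nonNeg (3 ℕ.+ k))) ,
    subst (0ℚ ≤_) (sym (trans (cong (λ d → U (7 ℕ.+ k) - d) (D-rec k))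
                              (rearrange⁻ u₄ u₅ u₃ (D k) (D (1 ℕ.+ k)))))
      (+-nonNeg (+-nonNeg hi₀ lo₁) (U-nonNeg (3 ℕ.+ k)))
    where
    u₃ u₄ u₅ : ℚ
    u₃ = U (3 ℕ.+ k)
    u₄ = U (4 ℕ.+ k)
    u₅ = U (5 ℕ.+ k)
    rearrange⁺ : ∀ x y z d e → ((y + z) + x) + (d - e) ≡ ((x + d) + (y - e)) + z
    rearrange⁺ = solve-∀ ℚ-ring
    rearrange⁻ : ∀ x y z d e → ((y + z) + x) - (d - e) ≡ ((x - d) + (y + e)) + z
    rearrange⁻ = solve-∀ ℚ-ring

  *-self-nonNeg : ∀ a → 0ℚ ≤ a * a
  *-self-nonNeg a with ≤-total 0ℚ a
  ... | inj₁ 0≤a = *-nonNeg 0≤a 0≤a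
  ... | inj₂ a≤0 = subst (0ℚ ≤_) (sym (identity a)) (*-nonNeg (≤⇒0≤- a≤0) (≤⇒0≤- a≤0))
    where
    identity : ∀ a → a * a ≡ (0ℚ - a) * (0ℚ - a)
    identity = solve-∀ ℚ-ring

  cubic>0⇒1≤a : ∀ a → 0ℚ < cubic a → 1ℚ ≤ a
  cubic>0⇒1≤a a 0<cubic with 1ℚ ≤? a
  ... | yes 1≤a = 1≤a
  ... | no  1≰a = ⊥-elim (<-irrefl refl (subst (0ℚ <_) (identity a)
          (+-pos (+-pos 0<1 (*-nonNeg (*-self-nonNeg a) (≤⇒0≤- (<⇒≤ (≰⇒> 1≰a))))) (<⇒≤ 0<cubic))))
    where
    identity : ∀ a → 1ℚ + a * a * (1ℚ - a) + (a * a * a - a * a - 1ℚ) ≡ 0ℚ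
    identity = solve-∀ ℚ-ring

  sq+-mono-≤ : ∀ {a b} → 0ℚ ≤ a → a ≤ b → sq+ a ≤ sq+ b
  sq+-mono-≤ {a} {b} 0≤a a≤b = 0≤-⇒≤ (subst (0ℚ ≤_) (sym (identity a b))
    (*-nonNeg (≤⇒0≤- a≤b) (+-nonNeg (+-nonNeg (≤-trans 0≤a a≤b) 0≤a) (<⇒≤ 0<1))))
    where
    identity : ∀ a b → (b * b + b) - (a * a + a) ≡ (b - a) * ((b + a) + 1ℚ)
    identity = solve-∀ ℚ-ring

  sq+-nonNeg : ∀ {a} → 0ℚ ≤ a → 0ℚ ≤ sq+ a
  sq+-nonNeg {a} 0≤a = +-nonNeg (*-nonNeg 0≤a 0≤a) 0≤a

  1≤⇒0≤ : ∀ {a} → 1ℚ ≤ a → 0ℚ ≤ a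
  1≤⇒0≤ = ≤-trans (<⇒≤ 0<1)

  1≤⇒0≤a*a-a : ∀ {a} → 1ℚ ≤ a → 0ℚ ≤ a * a - a
  1≤⇒0≤a*a-a {a} 1≤a = subst (0ℚ ≤_) (sym (identity a)) (*-nonNeg (1≤⇒0≤ 1≤a) (≤⇒0≤- 1≤a))
    where
    identity : ∀ a → a * a - a ≡ a * (a - 1ℚ)
    identity = solve-∀ ℚ-ring

  τ : ℚ → ℕ.ℕ → ℚ
  τ c k = (U (2 ℕ.+ k) + U (1 ℕ.+ k)) - c * U k

  τ-upper-certificate : ∀ a p q r →
    let c = a * a + a; u₃ = r + p; u₄ = u₃ + q; u₅ = u₄ + r; u₆ = u₅ + u₃
        D₀ = p * (u₃ + r) - q * (r + q); D₂ = r * (u₅ + u₄) - u₃ * (u₄ + u₃)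
    in ((c + three) - ((r + q) - c * p)) * (p + a * r + (a * a - a) * q)
       ≡ a * ((u₆ - D₂) + (r + r)) + (a * a - a) * ((u₄ + D₀) + (r + q + q)) + (r + q + three * p)
         + (a * a * a - a * a - 1ℚ) * (((a + 1ℚ) * q + r) * (p + 1ℚ))
  τ-upper-certificate = solve-∀ ℚ-ring

  τ-upper : ∀ a → 0ℚ < cubic a → ∀ k → τ (sq+ a) k ≤ sq+ a + three
  τ-upper a 0<cubic k = 0≤-⇒≤ (nonNeg-cancelʳ-pos 0<weight (subst (0ℚ ≤_) (sym (τ-upper-certificate a p q r))
    (+-nonNeg (+-nonNeg (+-nonNeg
      (*-nonNeg 0≤a (+-nonNeg (proj₂ (D-bounded (2 ℕ.+ k))) (+-nonNeg 0≤r 0≤r)))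
      (*-nonNeg 0≤a²-a (+-nonNeg (proj₁ (D-bounded k)) (+-nonNeg (+-nonNeg 0≤r 0≤q) 0≤q))))
      (+-nonNeg (+-nonNeg 0≤r 0≤q) (*-nonNeg (<⇒≤ 0<3) (<⇒≤ (U-pos k)))))
      (*-nonNeg (<⇒≤ 0<cubic) (*-nonNeg (+-nonNeg (*-nonNeg (+-nonNeg 0≤a (<⇒≤ 0<1)) 0≤q) 0≤r)
                                         (+-nonNeg (<⇒≤ (U-pos k)) (<⇒≤ 0<1)))))))
    where
    p q r : ℚ
    p = U k
    q = U (1 ℕ.+ k)
    r = U (2 ℕ.+ k)
    0≤q : 0ℚ ≤ q
    0≤q = U-nonNeg (1 ℕ.+ k)
    0≤r : 0ℚ ≤ r
    0≤r = U-nonNeg (2 ℕ.+ k)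
    1≤a : 1ℚ ≤ a
    1≤a = cubic>0⇒1≤a a 0<cubic
    0≤a : 0ℚ ≤ a
    0≤a = 1≤⇒0≤ 1≤a
    0≤a²-a : 0ℚ ≤ a * a - a
    0≤a²-a = 1≤⇒0≤a*a-a 1≤a
    0<weight : 0ℚ < p + a * r + (a * a - a) * q
    0<weight = +-pos (+-pos (U-pos k) (*-nonNeg 0≤a 0≤r)) (*-nonNeg 0≤a²-a 0≤q)

  three-N : ∀ k → three * (toℚ (N (3 ℕ.+ k) ℕ.∸ 1) + 1ℚ) ≡ U (2 ℕ.+ k) + U (1 ℕ.+ k)
  three-N k = begin
    toℚ 3 * (toℚ (N (3 ℕ.+ k) ℕ.∸ 1) + toℚ 1)   ≡⟨ cong (toℚ 3 *_) (toℚ-+ (N (3 ℕ.+ k) ℕ.∸ 1) 1) ⟨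
    toℚ 3 * toℚ (N (3 ℕ.+ k) ℕ.∸ 1 ℕ.+ 1)       ≡⟨ toℚ-* 3 (N (3 ℕ.+ k) ℕ.∸ 1 ℕ.+ 1) ⟨
    toℚ (3 ℕ.* (N (3 ℕ.+ k) ℕ.∸ 1 ℕ.+ 1))       ≡⟨ cong (λ n → toℚ (3 ℕ.* n)) (ℕ.m∸n+n≡m (N-pos (3 ℕ.+ k))) ⟩
    toℚ (3 ℕ.* N (3 ℕ.+ k))                     ≡⟨ cong toℚ (3N[3+k]≡u[2+k]+u[1+k] k) ⟩
    toℚ (u (2 ℕ.+ k) ℕ.+ u (1 ℕ.+ k))           ≡⟨ toℚ-+ (u (2 ℕ.+ k)) (u (1 ℕ.+ k)) ⟩
    toℚ (u (2 ℕ.+ k)) + toℚ (u (1 ℕ.+ k))       ≡⟨ cong₂ _+_ (toℚ-u (2 ℕ.+ k)) (toℚ-u (1 ℕ.+ k)) ⟩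
    U (2 ℕ.+ k) + U (1 ℕ.+ k)                   ∎
    where open ≡-Reasoning

  U+1≤three-B : ∀ k → U k + 1ℚ ≤ three * toℚ (2 ℕ.+ B k)
  U+1≤three-B k = subst₂ _≤_ (trans (toℚ-+ (u k) 1) (cong (_+ 1ℚ) (toℚ-u k))) (toℚ-* 3 (2 ℕ.+ B k))
    (toℚ-mono-≤ (u+1≤3[2+B] k))

  three-B≤U+2 : ∀ k → three * toℚ (2 ℕ.+ B k) ≤ U k + two
  three-B≤U+2 k = subst₂ _≤_ (toℚ-* 3 (2 ℕ.+ B k)) (trans (toℚ-+ (u k) 2) (cong (_+ two) (toℚ-u k)))
    (toℚ-mono-≤ (3[2+B]≤u+2 k))

  ratio≤-from-τ : ∀ {c p q r b e} → 0ℚ ≤ c → three * (e + 1ℚ) ≡ r + q → p + 1ℚ ≤ three * b →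
                (r + q) - c * p ≤ c + three → e ≤ c * b
  ratio≤-from-τ {c} {p} {q} {r} {b} {e} 0≤c hN hB hτ =
    0≤-⇒≤ (nonNeg-cancelʳ-pos 0<3 (subst (0ℚ ≤_) (sym (identity c p q r b e))
    (+-nonNeg (+-nonNeg (*-nonNeg 0≤c (≤⇒0≤- hB)) (≤⇒0≤- hτ)) (≤⇒0≤- (≤-reflexive hN)))))
    where
    identity : ∀ c p q r b e → (c * b - e) * three
      ≡ c * (three * b - (p + 1ℚ)) + ((c + three) - ((r + q) - c * p)) + ((r + q) - three * (e + 1ℚ))
    identity = solve-∀ ℚ-ring

  ratio>-from-τ : ∀ {c p q r b e} → 0ℚ ≤ c → three * (e + 1ℚ) ≡ r + q → three * b ≤ p + two →
                two * c + three < (r + q) - c * p → c * b < e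
  ratio>-from-τ {c} {p} {q} {r} {b} {e} 0≤c hN hB hτ =
    0<-⇒< (pos-cancelʳ-pos 0<3 (subst (0ℚ <_) (sym (identity c p q r b e))
    (+-pos (+-pos (<⇒0<- hτ) (*-nonNeg 0≤c (≤⇒0≤- hB))) (≤⇒0≤- (≤-reflexive (sym hN))))))
    where
    identity : ∀ c p q r b e → (e - c * b) * three
      ≡ (((r + q) - c * p) - (two * c + three)) + c * ((p + two) - three * b) + (three * (e + 1ℚ) - (r + q))
    identity = solve-∀ ℚ-ring

  τ-combination : ∀ a k → let c = sq+ a in
    τ c k + (a * a - a) * τ c (1 ℕ.+ k) + a * τ c (2 ℕ.+ k)
      ≡ (0ℚ - cubic a) * (U (2 ℕ.+ k) + (a + 1ℚ) * U (1 ℕ.+ k))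
  τ-combination a k = identity a (U k) (U (1 ℕ.+ k)) (U (2 ℕ.+ k))
    where
    identity : ∀ a p q r → let c = a * a + a in
      ((r + q) - c * p) + (a * a - a) * (((r + p) + r) - c * q) + a * ((((r + p) + q) + (r + p)) - c * r)
        ≡ (0ℚ - (a * a * a - a * a - 1ℚ)) * (r + (a + 1ℚ) * q)
    identity = solve-∀ ℚ-ring

  τ-exceeds : ∀ a → 1ℚ ≤ a → cubic a < 0ℚ → ∃[ k ] two * sq+ a + three < τ (sq+ a) (ℕ.suc k)
  τ-exceeds a 1≤a cubic<0 = pick (W <? τ c (1 ℕ.+ n)) (W <? τ c (2 ℕ.+ n)) (W <? τ c (3 ℕ.+ n))
    where
    c W δ : ℚ
    c = sq+ a
    W = two * c + three
    δ = 0ℚ - cubic a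
    0<δ : 0ℚ < δ
    0<δ = <⇒0<- cubic<0
    n : ℕ.ℕ
    n = proj₁ (archimedean ((a * a + 1ℚ) * W) 0<δ)
    q r : ℚ
    q = U (2 ℕ.+ n)
    r = U (3 ℕ.+ n)
    0≤a : 0ℚ ≤ a
    0≤a = 1≤⇒0≤ 1≤a
    0≤a²-a : 0ℚ ≤ a * a - a
    0≤a²-a = 1≤⇒0≤a*a-a 1≤a
    n≤r+[a+1]q : toℚ n ≤ r + (a + 1ℚ) * q
    n≤r+[a+1]q = 0≤-⇒≤ (subst (0ℚ ≤_) (sym (identity r (toℚ n) ((a + 1ℚ) * q)))
      (+-nonNeg (≤⇒0≤- n≤r) (*-nonNeg (+-nonNeg 0≤a (<⇒≤ 0<1)) (U-nonNeg (2 ℕ.+ n)))))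
      where
      n≤r : toℚ n ≤ r
      n≤r = subst (toℚ n ≤_) (toℚ-u (3 ℕ.+ n))
                  (toℚ-mono-≤ (ℕ.≤-trans (ℕ.m≤n+m n 3) (ℕ.<⇒≤ (k<u[k] (3 ℕ.+ n)))))
      identity : ∀ r n x → (r + x) - n ≡ (r - n) + x
      identity = solve-∀ ℚ-ring
    combination≤ : τ c (1 ℕ.+ n) ≤ W → τ c (2 ℕ.+ n) ≤ W → τ c (3 ℕ.+ n) ≤ W →
                   τ c (1 ℕ.+ n) + (a * a - a) * τ c (2 ℕ.+ n) + a * τ c (3 ℕ.+ n) ≤ (a * a + 1ℚ) * W
    combination≤ h₀ h₁ h₂ = 0≤-⇒≤ (subst (0ℚ ≤_) (sym (identity a W _ _ _))
      (+-nonNeg (+-nonNeg (≤⇒0≤- h₀) (*-nonNeg 0≤a²-a (≤⇒0≤- h₁))) (*-nonNeg 0≤a (≤⇒0≤- h₂))))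
      where
      identity : ∀ a w t₀ t₁ t₂ → (a * a + 1ℚ) * w - (t₀ + (a * a - a) * t₁ + a * t₂)
        ≡ (w - t₀) + (a * a - a) * (w - t₁) + a * (w - t₂)
      identity = solve-∀ ℚ-ring
    pick : Dec (W < τ c (1 ℕ.+ n)) → Dec (W < τ c (2 ℕ.+ n)) → Dec (W < τ c (3 ℕ.+ n)) →
           ∃[ k ] W < τ c (ℕ.suc k)
    pick (yes W<τ₀) _          _          = n , W<τ₀
    pick (no  _)    (yes W<τ₁) _          = 1 ℕ.+ n , W<τ₁
    pick (no  _)    (no  _)    (yes W<τ₂) = 2 ℕ.+ n , W<τ₂
    pick (no  W≮τ₀) (no  W≮τ₁) (no  W≮τ₂) = ⊥-elim (<-irrefl refl (begin-strict
      δ * toℚ n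
        ≤⟨ *-monoˡ-≤-nonNeg δ {{nonNegative (<⇒≤ 0<δ)}} n≤r+[a+1]q ⟩
      δ * (r + (a + 1ℚ) * q)
        ≡⟨ τ-combination a (1 ℕ.+ n) ⟨
      τ c (1 ℕ.+ n) + (a * a - a) * τ c (2 ℕ.+ n) + a * τ c (3 ℕ.+ n)
        ≤⟨ combination≤ (≮⇒≥ W≮τ₀) (≮⇒≥ W≮τ₁) (≮⇒≥ W≮τ₂) ⟩
      (a * a + 1ℚ) * W
        <⟨ proj₂ (archimedean ((a * a + 1ℚ) * W) 0<δ) ⟩
      δ * toℚ n
        ∎))
      where open ≤-Reasoning

  ratio-bounded-at : ∀ a → 0ℚ < cubic a → ∀ k → toℚ (N (3 ℕ.+ k) ℕ.∸ 1) ≤ sq+ a * toℚ (2 ℕ.+ B k)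
  ratio-bounded-at a 0<cubic k =
    ratio≤-from-τ {sq+ a} {U k} {U (1 ℕ.+ k)} {U (2 ℕ.+ k)} {toℚ (2 ℕ.+ B k)} {toℚ (N (3 ℕ.+ k) ℕ.∸ 1)}
      (sq+-nonNeg (1≤⇒0≤ (cubic>0⇒1≤a a 0<cubic))) (three-N k) (U+1≤three-B k) (τ-upper a 0<cubic k)

  ratio-bounded : ∀ a → 0ℚ < cubic a → ∀ k {x m} → x ℕ.≤ N (3 ℕ.+ k) ℕ.∸ 1 → 2 ℕ.+ B k ℕ.≤ m →
                  toℚ x ≤ sq+ a * toℚ m
  ratio-bounded a 0<cubic k {x} {m} x≤ 2+Bk≤m = begin
    toℚ x                        ≤⟨ toℚ-mono-≤ x≤ ⟩
    toℚ (N (3 ℕ.+ k) ℕ.∸ 1)      ≤⟨ ratio-bounded-at a 0<cubic k ⟩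
    sq+ a * toℚ (2 ℕ.+ B k)      ≤⟨ *-monoˡ-≤-nonNeg (sq+ a) {{nonNegative 0≤sq+a}} (toℚ-mono-≤ 2+Bk≤m) ⟩
    sq+ a * toℚ m                ∎
    where
    open ≤-Reasoning
    0≤sq+a : 0ℚ ≤ sq+ a
    0≤sq+a = sq+-nonNeg (1≤⇒0≤ (cubic>0⇒1≤a a 0<cubic))

  ratio-bounded-1 : ∀ a → 0ℚ < cubic a → ∀ {x} → x ℕ.≤ 2 → toℚ x ≤ sq+ a * toℚ 1
  ratio-bounded-1 a 0<cubic x≤2 = ≤-trans (toℚ-mono-≤ x≤2)
    (subst (sq+ 1ℚ ≤_) (sym (*-identityʳ (sq+ a))) (sq+-mono-≤ (<⇒≤ 0<1) (cubic>0⇒1≤a a 0<cubic)))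

  RatioExceeds : ℚ → ℕ.ℕ → Set
  RatioExceeds a k = sq+ a * toℚ (2 ℕ.+ B (ℕ.suc k)) < toℚ (N (4 ℕ.+ k) ℕ.∸ 1)

  ratio-exceeds-1≤a : ∀ a → 1ℚ ≤ a → cubic a < 0ℚ → ∃[ k ] RatioExceeds a k
  ratio-exceeds-1≤a a 1≤a cubic<0 = k ,
    ratio>-from-τ {sq+ a} {U (ℕ.suc k)} {U (2 ℕ.+ k)} {U (3 ℕ.+ k)} {toℚ (2 ℕ.+ B (ℕ.suc k))} {toℚ (N (4 ℕ.+ k) ℕ.∸ 1)}
      (sq+-nonNeg (1≤⇒0≤ 1≤a)) (three-N (ℕ.suc k)) (three-B≤U+2 (ℕ.suc k)) (proj₂ (τ-exceeds a 1≤a cubic<0))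
    where
    k : ℕ.ℕ
    k = proj₁ (τ-exceeds a 1≤a cubic<0)

  cubic[1]<0 : cubic 1ℚ < 0ℚ
  cubic[1]<0 = *<* ℤ.-<+

  ratio-exceeds : ∀ a → 0ℚ ≤ a → cubic a < 0ℚ → ∃[ k ] RatioExceeds a k
  ratio-exceeds a 0≤a cubic<0 = by-cases (1ℚ ≤? a)
    where
    by-cases : Dec (1ℚ ≤ a) → ∃[ k ] RatioExceeds a k
    by-cases (yes 1≤a) = ratio-exceeds-1≤a a 1≤a cubic<0
    by-cases (no  1≰a) = k , ≤-<-trans (*-monoʳ-≤-nonNeg b {{nonNegative 0≤b}} sq+a≤sq+1) 1-exceeds
      where
      k : ℕ.ℕ
      k = proj₁ (ratio-exceeds-1≤a 1ℚ ≤-refl cubic[1]<0)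
      1-exceeds : RatioExceeds 1ℚ k
      1-exceeds = proj₂ (ratio-exceeds-1≤a 1ℚ ≤-refl cubic[1]<0)
      b : ℚ
      b = toℚ (2 ℕ.+ B (ℕ.suc k))
      0≤b : 0ℚ ≤ b
      0≤b = toℚ-nonNeg (2 ℕ.+ B (ℕ.suc k))
      sq+a≤sq+1 : sq+ a ≤ sq+ 1ℚ
      sq+a≤sq+1 = sq+-mono-≤ 0≤a (<⇒≤ (≰⇒> 1≰a))

open import Data.Nat using (ℕ; suc; _+_; _≤_; s≤s; z≤n)
open import Data.Product using (Σ; _×_; _,_)
import Data.Rational as ℚ
open ℚ using (ℚ; 0ℚ)
open Sequences using (B)
open Factors using (IsA-1≤2; IsA-bracket; IsA-2+B[1+k])
open Estimates using (ratio-bounded; ratio-bounded-1; ratio-exceeds)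

corollary10 :
    -- A_m / m ≤ α² + α for all m ≥ 1 : for every rational a > α (i.e. a³-a²-1 > 0), A_m ≤ (a²+a)·m
    ((m x : ℕ) → 1 ≤ m → IsA m x →
      (a : ℚ) → 0ℚ ℚ.< cubic a → toℚ x ℚ.≤ sq+ a ℚ.* toℚ m)
    ×
    -- optimality: for every rational 0 ≤ a < α (i.e. a³-a²-1 < 0) some A_m / m exceeds a² + a
    ((a : ℚ) → 0ℚ ℚ.≤ a → cubic a ℚ.< 0ℚ →
      Σ ℕ (λ m → Σ ℕ (λ x → 1 ≤ m × IsA m x × sq+ a ℚ.* toℚ m ℚ.< toℚ x)))
corollary10 = upper , lower
  where
  upper : (m x : ℕ) → 1 ≤ m → IsA m x → (a : ℚ) → 0ℚ ℚ.< cubic a → toℚ x ℚ.≤ sq+ a ℚ.* toℚ m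
  upper 1 x _ isA a 0<cubic = ratio-bounded-1 a 0<cubic (IsA-1≤2 isA)
  upper (suc (suc d)) x _ isA a 0<cubic with IsA-bracket (s≤s (s≤s z≤n)) isA
  ... | k , x≤ , 2+Bk≤m = ratio-bounded a 0<cubic k x≤ 2+Bk≤m
  lower : (a : ℚ) → 0ℚ ℚ.≤ a → cubic a ℚ.< 0ℚ →
          Σ ℕ (λ m → Σ ℕ (λ x → 1 ≤ m × IsA m x × sq+ a ℚ.* toℚ m ℚ.< toℚ x))
  lower a 0≤a cubic<0 with ratio-exceeds a 0≤a cubic<0
  ... | k , exceeds = 2 + B (suc k) , _ , s≤s z≤n , IsA-2+B[1+k] k , exceeds
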